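{- Let $t$ be a positive integer and $\lambda$ a partition with characteristic vector $c=(c_0,\ldots,c_{t-1})$ and $t$-quotient $(\lambda^0,\ldots,\lambda^{t-1})$. Let $J^+=\{j: c_j\ge0\}$, $J^-=\{j:c_j<0\}$, $\alpha=\sum_{j\in J^+}|\{l\in L^+(\lambda^j): l<c_j\}|$ and $\beta=\sum_{j\in J^- }|\{a\in A^+(\lambda^j): a<|c_j|\}|$. Then $$s(\mathcal Q_t(\lambda))=\sum_{j=0}^{t-1}s(\lambda^j)\quad\text{and}\quad s(\lambda)+\alpha+\beta=s(\mathcal Q_t(\lambda))+s(\lambda_{(t)}).$$
   Context: $\mathbb N=\{0,1,2,\ldots\}$. $s(\mu)=\#\{i:\mu_i\ge i\}$ is the Durfee number of a partition $\mu$; arm set $A^+(\mu)=\{\mu_i-i:1\le i\le s(\mu)\}$, leg set $L^+(\mu)=\{\mu^*_i-i:1\le i\le s(\mu)\}$ ($\mu^*$ the conjugate); any two finite subsets of $\mathbb N$ of equal size are the leg and arm sets of a unique partition. For $0\le j\le t-1$: $\widetilde A_j^+(\lambda)=\{q\in\mathbb N:qt+j\in A^+(\lambda)\}$, $\widetilde L_j^+(\lambda)=\{q\in\mathbb N:qt+t-j-1\in L^+(\lambda)\}$, $c_j=|\widetilde A_j^+(\lambda)|-|\widetilde L_j^+(\lambda)|$ (characteristic vector). With $S_j=\widetilde A_j^+(\lambda)\cup\{ -q-1:q\in\mathbb N\setminus\widetilde L_j^+(\lambda)\}$, $\lambda^j$ is the partition with $A^+(\lambda^j)=\{x\in\mathbb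 N:x+c_j\in S_j\}$, $L^+(\lambda^j)=\{y\in\mathbb N:c_j-y-1\notin S_j\}$ ($t$-quotient). The map $\lambda\mapsto(c_t(\lambda),(\lambda^0,\ldots,\lambda^{t-1}))$ is a bijection from partitions onto pairs (integer $t$-tuple with sum $0$, $t$-tuple of partitions). $\mathcal Q_t(\lambda)$ is the partition with characteristic vector $(0,\ldots,0)$ and $t$-quotient $(\lambda^0,\ldots,\lambda^{t-1})$. $\lambda_{(t)}$ (the $t$-core of $\lambda$) is the partition with arm set $\{qt+j:0\le q<c_j\}$ and leg set $\{qt+t-j-1: 0\le q<-c_j\}$ (over $0\le j\le t-1$). -}

module Defs where

open import Data.Nat using (ℕ; zero; suc; _∸_; _≤?_; _<?_; _*_; NonZero)
  renaming (_+_ to _+ℕ_)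
open import Data.Nat.DivMod using (_/_; _%_)
import Data.Nat as ℕ
open import Data.Integer as ℤ using (ℤ; +_; -[1+_]; _-_; _+_; -_; _<_)
open import Data.Fin using (Fin; toℕ)
open import Data.List using (List; []; _∷_; length; map; filter; upTo; tabulate)
open import Data.Nat.ListAction using (sum)
open import Data.Empty using (⊥)
open import Data.List.Relation.Unary.All using (All)
open import Data.List.Relation.Unary.Linked using (Linked)
open import Data.List.Membership.Propositional using (_∈_; _∉_)
open import Data.Product using (_×_; ∃-syntax)
open import Function.Bundles using (_⇔_)
open import Relation.Binary.PropositionalEquality using (_≡_)

record Partition : Set where
  constructor mkPartition
  field
    parts      : List ℕ
    decreasing : Linked ℕ._≥_ parts
    positive   : All (ℕ._<_ 0) parts
open Partition public

at : List ℕ → ℕ → ℕ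
at []       _       = 0
at (x ∷ xs) zero    = x
at (x ∷ xs) (suc i) = at xs i

-- μ_i for i ≥ 1 (μ_i = 0 beyond the length)
part : Partition → ℕ → ℕ
part μ zero    = 0
part μ (suc i) = at (parts μ) i

conj : Partition → ℕ → ℕ
conj μ i = length (filter (i ≤?_) (parts μ))

oneTo : ℕ → List ℕ
oneTo n = map suc (upTo n)

-- Durfee number s(μ) = #{i ≥ 1 : μ_i ≥ i}  (such i are ≤ length of μ)
durfee : Partition → ℕ
durfee μ = length (filter (λ i → i ≤? part μ i) (oneTo (length (parts μ))))

A⁺ : Partition → List ℕ
A⁺ μ = map (λ i → part μ i ∸ i) (oneTo (durfee μ))

L⁺ : Partition → List ℕ
L⁺ μ = map (λ i → conj μ i ∸ i) (oneTo (durfee μ))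

module _ (t : ℕ) .{{_ : NonZero t}} where

  Ã⁺ : Partition → Fin t → List ℕ
  Ã⁺ la j = map (_/ t) (filter (λ a → a % t ℕ.≟ toℕ j) (A⁺ la))

  L̃⁺ : Partition → Fin t → List ℕ
  L̃⁺ la j = map (_/ t) (filter (λ a → a % t ℕ.≟ (t ∸ suc (toℕ j))) (L⁺ la))

  charVec : Partition → Fin t → ℤ
  charVec la j = + length (Ã⁺ la j) - + length (L̃⁺ la j)

  -- membership in S_j = Ã_j⁺ ∪ {-q-1 : q ∈ ℕ \ L̃_j⁺}
  InS : Partition → Fin t → ℤ → Set
  InS la j (+ n)     = n ∈ Ã⁺ la j
  InS la j -[1+ q ]  = q ∉ L̃⁺ la j

  IsQuotient : Partition → Fin t → Partition → Set
  IsQuotient la j μ =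
    (∀ x → (x ∈ A⁺ μ) ⇔ InS la j (+ x + charVec la j)) ×
    (∀ y → (y ∈ L⁺ μ) ⇔ (InS la j (charVec la j - + y - + 1) → ⊥))

  IsCore : Partition → Partition → Set
  IsCore la κ =
    (∀ x → (x ∈ A⁺ κ) ⇔ (∃[ j ] ∃[ q ] ((+ q < charVec la j) × (x ≡ q * t +ℕ toℕ j)))) ×
    (∀ y → (y ∈ L⁺ κ) ⇔ (∃[ j ] ∃[ q ] ((+ q < - charVec la j) × (y ≡ q * t +ℕ (t ∸ suc (toℕ j))))))

Σ[j<_]_ : (t : ℕ) → (Fin t → ℕ) → ℕ
Σ[j< t ] f = sum (tabulate f)

αTerm : ℤ → Partition → ℕ
αTerm (+ n)     μ = length (filter (_<? n) (L⁺ μ))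
αTerm -[1+ m ]  μ = 0

βTerm : ℤ → Partition → ℕ
βTerm (+ n)     μ = 0
βTerm -[1+ m ]  μ = length (filter (_<? suc m) (A⁺ μ))

module Submission where

-- Sorting the arm set of λ by residues mod t gives s(λ) = Σⱼ |Ã_j⁺|, because
-- |A⁺(μ)| = s(μ) for every partition. For a single j the quotient description
-- compares Ã_j⁺ with A⁺(λ^j) shifted by c_j. If c_j ≥ 0, Ã_j⁺ splits into its
-- part below c_j and a copy of A⁺(λ^j), while the legs of λ^j below c_j are the
-- reflections q ↦ c_j - 1 - q of the complement of that part; so
-- |Ã_j⁺| + α_j = s(λ^j) + c_j. If c_j < 0, A⁺(λ^j) splits into its part below
-- |c_j| and a copy of Ã_j⁺; so |Ã_j⁺| + β_j = s(λ^j). Summing over j gives the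
-- second identity once one knows |Ã_j⁺(λ_(t))| = max(c_j, 0). For Q all c_j
-- vanish, A⁺(λ^j) = Ã_j⁺(Q), and the same residue decomposition gives the first.

open import Defs
open import Algebra.Properties.CommutativeSemigroup using (interchange)
open import Data.Empty using (⊥-elim)
open import Data.Fin as Fin using (Fin; toℕ)
open import Data.Fin.Properties using (toℕ<n; toℕ-injective)
open import Data.Integer as ℤ using (ℤ; 0ℤ)
import Data.Integer.Properties as ℤ
open import Data.List using (List; []; _∷_; length; map; filter; upTo; applyUpTo)
open import Data.List.Properties using (length-map; length-upTo; map-applyUpTo; tabulate-cong)
open import Data.List.Membership.Propositional using (_∈_; _∉_)
open import Data.List.Membership.Propositional.Properties
  using (∈-map⁺; ∈-map⁻; ∈-filter⁺; ∈-filter⁻; ∈-upTo⁺; ∈-upTo⁻)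
open import Data.List.Relation.Binary.Sublist.Propositional using (⊆-refl)
open import Data.List.Relation.Binary.Sublist.Propositional.Properties using (filter⁺; length-mono-≤)
open import Data.List.Relation.Unary.All as All using (All; []; _∷_)
import Data.List.Relation.Unary.All.Properties as All
import Data.List.Relation.Unary.AllPairs.Properties as AllPairs
open import Data.List.Relation.Unary.Any.Properties using (∷↔)
open import Data.List.Relation.Unary.Linked using (Linked; []; [-]; _∷_)
open import Data.List.Relation.Unary.Unique.Propositional using (Unique; []; _∷_)
import Data.List.Relation.Unary.Unique.Propositional.Properties as Unique
open import Data.Nat
  using (ℕ; NonZero; zero; suc; _+_; _*_; _∸_; _≤_; _<_; _≥_; _≟_; _≤?_; _<?_)
  using (z≤n; s≤s; z<s; s<s; s≤s⁻¹; s<s⁻¹)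
open import Data.List.Membership.DecPropositional _≟_ using (_∈?_)
open import Data.Nat.DivMod
  using (_/_; _%_; m≡m%n+[m/n]*n; [m+kn]%n≡m%n; m<n⇒m%n≡m; m%n<n; +-distrib-/; m*n%n≡0; m*n/n≡m; m<n⇒m/n≡0)
open import Data.Nat.ListAction using (sum)
open import Data.Nat.Properties
open import Data.Product using (_×_; _,_; proj₁; proj₂)
open import Data.Bool using (Bool; true; false)
open import Function.Base using (_∘_; id)
open import Function.Bundles using (_⇔_; mk⇔; Equivalence)
open import Function.Properties.Equivalence using () renaming (sym to ⇔-sym; trans to ⇔-trans)
open import Function.Properties.Inverse using (↔⇒⇔)
open import Relation.Nullary using (Dec; yes; no; does; ¬_; ¬?; _⊎-dec_; contradiction)
open import Relation.Nullary.Decidable using (does-⇔)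
open import Relation.Unary using (Decidable)
open import Relation.Binary.PropositionalEquality
  using (_≡_; refl; sym; trans; cong; cong₂; subst; module ≡-Reasoning)

open Equivalence using (to; from)
open ≡-Reasoning

indicator : Bool → ℕ
indicator true  = 1
indicator false = 0

count : {P : ℕ → Set} → Decidable P → ℕ → ℕ
count P? zero    = 0
count P? (suc n) = indicator (does (P? 0)) + count (P? ∘ suc) n

private variable
  P Q : ℕ → Set

count-cong : ∀ n (P? : Decidable P) (Q? : Decidable Q) →
             (∀ {x} → x < n → P x ⇔ Q x) → count P? n ≡ count Q? n
count-cong zero    _  _  P⇔Q = refl
count-cong (suc n) P? Q? P⇔Q =
  cong₂ _+_ (cong indicator (does-⇔ (P⇔Q z<s) (P? 0) (Q? 0)))
            (count-cong n (P? ∘ suc) (Q? ∘ suc) (P⇔Q ∘ s<s))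

count-⊎ : ∀ n (P? : Decidable P) (Q? : Decidable Q) → (∀ x → P x → ¬ Q x) →
          count (λ x → P? x ⊎-dec Q? x) n ≡ count P? n + count Q? n
count-⊎ zero    P? Q? disjoint = refl
count-⊎ (suc n) P? Q? disjoint = begin
  indicator (does (P? 0 ⊎-dec Q? 0)) + count (λ x → P? (suc x) ⊎-dec Q? (suc x)) n
    ≡⟨ cong₂ _+_ (indicator-⊎ (P? 0) (Q? 0) (disjoint 0))
                 (count-⊎ n (P? ∘ suc) (Q? ∘ suc) (disjoint ∘ suc)) ⟩
  (indicator (does (P? 0)) + indicator (does (Q? 0))) + (count (P? ∘ suc) n + count (Q? ∘ suc) n)
    ≡⟨ interchange +-commutativeSemigroup (indicator (does (P? 0))) (indicator (does (Q? 0)))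
                                          (count (P? ∘ suc) n) (count (Q? ∘ suc) n) ⟩
  count P? (suc n) + count Q? (suc n) ∎
  where
    indicator-⊎ : ∀ {A B : Set} (a? : Dec A) (b? : Dec B) → (A → ¬ B) →
                  indicator (does (a? ⊎-dec b?)) ≡ indicator (does a?) + indicator (does b?)
    indicator-⊎ (yes a) (yes b) a⇒¬b = ⊥-elim (a⇒¬b a b)
    indicator-⊎ (yes _) (no _)  _    = refl
    indicator-⊎ (no _)  _       _    = refl

count-snoc : ∀ n (P? : Decidable P) → count P? (suc n) ≡ count P? n + indicator (does (P? n))
count-snoc zero    P? = +-comm (indicator (does (P? 0))) 0
count-snoc (suc n) P? =
  trans (cong (indicator (does (P? 0)) +_) (count-snoc n (P? ∘ suc)))
        (sym (+-assoc (indicator (does (P? 0))) (count (P? ∘ suc) n) (indicator (does (P? (suc n))))))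

count-+ : ∀ m n (P? : Decidable P) → count P? (m + n) ≡ count P? m + count (P? ∘ (m +_)) n
count-+ zero    n P? = refl
count-+ (suc m) n P? =
  trans (cong (indicator (does (P? 0)) +_) (count-+ m n (P? ∘ suc)))
        (sym (+-assoc (indicator (does (P? 0))) (count (P? ∘ suc) m) (count (P? ∘ suc ∘ (m +_)) n)))

count-reverse : ∀ n (P? : Decidable P) → count (λ x → P? (n ∸ suc x)) n ≡ count P? n
count-reverse zero    P? = refl
count-reverse (suc n) P? = begin
  indicator (does (P? n)) + count (λ x → P? (n ∸ suc x)) n
    ≡⟨ cong (indicator (does (P? n)) +_) (count-reverse n P?) ⟩
  indicator (does (P? n)) + count P? n
    ≡⟨ +-comm (indicator (does (P? n))) (count P? n) ⟩
  count P? n + indicator (does (P? n))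
    ≡⟨ count-snoc n P? ⟨
  count P? (suc n) ∎

count-complement : ∀ n (P? : Decidable P) → count P? n + count (¬? ∘ P?) n ≡ n
count-complement zero    P? = refl
count-complement (suc n) P? =
  trans (interchange +-commutativeSemigroup (indicator (does (P? 0))) (count (P? ∘ suc) n)
                                            (indicator (does (¬? (P? 0)))) (count (¬? ∘ P? ∘ suc) n))
        (cong₂ _+_ (indicator-complement (P? 0)) (count-complement n (P? ∘ suc)))
  where
    indicator-complement : ∀ {A : Set} (a? : Dec A) → indicator (does a?) + indicator (does (¬? a?)) ≡ 1
    indicator-complement (yes _) = refl
    indicator-complement (no _)  = refl

count-none : ∀ n {P? : Decidable P} → (∀ x → ¬ P x) → count P? n ≡ 0
count-none zero            none = refl
count-none (suc n) {P?} none with P? 0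
... | yes p0 = ⊥-elim (none 0 p0)
... | no _   = count-none n (none ∘ suc)

count-downClosed : ∀ n {P? : Decidable P} → (∀ x → P (suc x) → P x) →
                   ∀ {i} → i < count P? n → P i
count-downClosed {P} (suc n) {P?} closed {i} i<count with P? 0 | i
... | yes p0 | zero   = p0
... | yes _  | suc _  = count-downClosed n (closed ∘ suc) (s<s⁻¹ i<count)
... | no ¬p0 | _      =
  contradiction (subst (_ <_) (count-none n (λ x → ¬p0 ∘ reaches0 (suc x))) i<count) λ ()
  where
    reaches0 : ∀ x → P x → P 0
    reaches0 zero    p = p
    reaches0 (suc x) p = reaches0 x (closed x p)

count-≡ : ∀ {a n} → a < n → count (_≟ a) n ≡ 1
count-≡ {zero}  {suc n} _         = cong suc (count-none n (λ _ ()))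
count-≡ {suc a} {suc n} (s<s a<n) =
  trans (count-cong n ((_≟ suc a) ∘ suc) (_≟ a) (λ _ → mk⇔ suc-injective (cong suc))) (count-≡ a<n)

Σ-cong : ∀ t {f g : Fin t → ℕ} → (∀ j → f j ≡ g j) → Σ[j< t ] f ≡ Σ[j< t ] g
Σ-cong t f≗g = cong sum (tabulate-cong f≗g)

Σ-zero : ∀ t → Σ[j< t ] (λ _ → 0) ≡ 0
Σ-zero zero    = refl
Σ-zero (suc t) = Σ-zero t

Σ-distrib-+ : ∀ t (f g : Fin t → ℕ) → Σ[j< t ] (λ j → f j + g j) ≡ Σ[j< t ] f + Σ[j< t ] g
Σ-distrib-+ zero    f g = refl
Σ-distrib-+ (suc t) f g =
  trans (cong (f Fin.zero + g Fin.zero +_) (Σ-distrib-+ t (f ∘ Fin.suc) (g ∘ Fin.suc)))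
        (interchange +-commutativeSemigroup (f Fin.zero) (g Fin.zero)
                                            (Σ[j< t ] (f ∘ Fin.suc)) (Σ[j< t ] (g ∘ Fin.suc)))

Σ-indicator : ∀ t (P? : Decidable P) →
              Σ[j< t ] (λ j → indicator (does (P? (toℕ j)))) ≡ count P? t
Σ-indicator zero    P? = refl
Σ-indicator (suc t) P? = cong (indicator (does (P? 0)) +_) (Σ-indicator t (P? ∘ suc))

length-filter-∷ : ∀ {A : Set} {P : A → Set} (P? : Decidable P) x xs →
                  length (filter P? (x ∷ xs)) ≡ indicator (does (P? x)) + length (filter P? xs)
length-filter-∷ P? x xs with does (P? x)
... | true  = refl
... | false = refl

length-filter-applyUpTo : ∀ {A : Set} {P : A → Set} (P? : Decidable P) (f : ℕ → A) n →
                          length (filter P? (applyUpTo f n)) ≡ count (P? ∘ f) n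
length-filter-applyUpTo P? f zero    = refl
length-filter-applyUpTo P? f (suc n) =
  trans (length-filter-∷ P? (f 0) (applyUpTo (f ∘ suc) n))
        (cong (indicator (does (P? (f 0))) +_) (length-filter-applyUpTo P? (f ∘ suc) n))

all<-sum : ∀ xs {n} → sum xs < n → All (_< n) xs
all<-sum []       _       = []
all<-sum (x ∷ xs) sum<n =
  ≤-<-trans (m≤m+n x (sum xs)) sum<n ∷ all<-sum xs (≤-<-trans (m≤n+m (sum xs) x) sum<n)

length≡count : ∀ {xs} n → Unique xs → All (_< n) xs → length xs ≡ count (_∈? xs) n
length≡count {[]}     n _             _             = sym (count-none n (λ _ ()))
length≡count {y ∷ ys} n (y∉ys ∷ uys) (y<n ∷ ys<n) = begin
  1 + length ys                                      ≡⟨ cong₂ _+_ (sym (count-≡ y<n)) (length≡count n uys ys<n) ⟩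
  count (_≟ y) n + count (_∈? ys) n                  ≡⟨ count-⊎ n (_≟ y) (_∈? ys) y-fresh ⟨
  count (λ x → (x ≟ y) ⊎-dec (x ∈? ys)) n            ≡⟨ count-cong n _ (_∈? (y ∷ ys)) (λ _ → ↔⇒⇔ (∷↔ _)) ⟩
  count (_∈? (y ∷ ys)) n                             ∎
  where
    y-fresh : ∀ x → x ≡ y → x ∉ ys
    y-fresh x x≡y x∈ys = All.lookup y∉ys x∈ys (sym x≡y)

length-filter-<≡count : ∀ {xs} n → Unique xs → length (filter (_<? n) xs) ≡ count (_∈? xs) n
length-filter-<≡count {xs} n uxs =
  trans (length≡count n (Unique.filter⁺ (_<? n) uxs) (All.all-filter (_<? n) xs))
        (count-cong n _ (_∈? xs)
                    (λ x<n → mk⇔ (proj₁ ∘ ∈-filter⁻ (_<? n)) (λ x∈xs → ∈-filter⁺ (_<? n) x∈xs x<n)))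

length-cong : ∀ {xs ys} → Unique xs → Unique ys → (∀ x → x ∈ xs ⇔ x ∈ ys) → length xs ≡ length ys
length-cong {xs} {ys} uxs uys xs⇔ys = begin
  length xs        ≡⟨ length≡count N uxs (all<-sum xs (s≤s (m≤m+n _ _))) ⟩
  count (_∈? xs) N ≡⟨ count-cong N (_∈? xs) (_∈? ys) (λ {x} _ → xs⇔ys x) ⟩
  count (_∈? ys) N ≡⟨ length≡count N uys (all<-sum ys (s≤s (m≤n+m _ _))) ⟨
  length ys        ∎
  where N = suc (sum xs + sum ys)

length-split : ∀ n {xs ys} → Unique xs → Unique ys → (∀ y → y ∈ ys ⇔ n + y ∈ xs) →
               length xs ≡ length ys + length (filter (_<? n) xs)
length-split n {xs} {ys} uxs uys ys⇔xs = begin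
  length xs
    ≡⟨ length≡count (n + N) uxs (all<-sum xs (≤-trans (s≤s (m≤m+n _ _)) (m≤n+m N n))) ⟩
  count (_∈? xs) (n + N)
    ≡⟨ count-+ n N (_∈? xs) ⟩
  count (_∈? xs) n + count (λ y → n + y ∈? xs) N
    ≡⟨ +-comm (count (_∈? xs) n) (count (λ y → n + y ∈? xs) N) ⟩
  count (λ y → n + y ∈? xs) N + count (_∈? xs) n
    ≡⟨ cong₂ _+_ (count-cong N (_∈? ys) (λ y → n + y ∈? xs) (λ {y} _ → ys⇔xs y))
                 (length-filter-<≡count n uxs) ⟨
  count (_∈? ys) N + length (filter (_<? n) xs)
    ≡⟨ cong (_+ length (filter (_<? n) xs)) (length≡count N uys (all<-sum ys (s≤s (m≤n+m _ _)))) ⟨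
  length ys + length (filter (_<? n) xs) ∎
  where N = suc (sum xs + sum ys)

length-filter-<-reflect : ∀ n {xs ys} → Unique xs → Unique ys →
                          (∀ {y} → y < n → y ∈ ys ⇔ n ∸ suc y ∉ xs) →
                          length (filter (_<? n) xs) + length (filter (_<? n) ys) ≡ n
length-filter-<-reflect n {xs} {ys} uxs uys ys⇔∉xs = begin
  length (filter (_<? n) xs) + length (filter (_<? n) ys)
    ≡⟨ cong₂ _+_ (length-filter-<≡count n uxs) (length-filter-<≡count n uys) ⟩
  count (_∈? xs) n + count (_∈? ys) n
    ≡⟨ cong₂ _+_ (count-reverse n (_∈? xs))
                 (count-cong n (λ y → ¬? (n ∸ suc y ∈? xs)) (_∈? ys) (⇔-sym ∘ ys⇔∉xs)) ⟨
  count (λ y → n ∸ suc y ∈? xs) n + count (λ y → ¬? (n ∸ suc y ∈? xs)) n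
    ≡⟨ count-complement n (λ y → n ∸ suc y ∈? xs) ⟩
  n ∎

at-antitone : ∀ {ps} → Linked _≥_ ps → ∀ {i k} → i ≤ k → at ps k ≤ at ps i
at-antitone []       _                  = ≤-refl
at-antitone [-]      {zero}  {zero}  _  = ≤-refl
at-antitone [-]      {_}     {suc k} _  = z≤n
at-antitone (p≥q ∷ l) {zero} {zero}  _  = ≤-refl
at-antitone (p≥q ∷ l) {zero} {suc k} _  = ≤-trans (at-antitone l {0} {k} z≤n) p≥q
at-antitone (p≥q ∷ l) {suc i} {suc k} i≤k = at-antitone l (s≤s⁻¹ i≤k)

part-antitone : ∀ μ {i k} → i ≤ k → part μ (suc k) ≤ part μ (suc i)
part-antitone μ = at-antitone (decreasing μ)

conj-antitone : ∀ μ {i k} → i ≤ k → conj μ k ≤ conj μ i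
conj-antitone μ {i} {k} i≤k =
  length-mono-≤ (filter⁺ (k ≤?_) (i ≤?_) (λ { refl k≤p → ≤-trans i≤k k≤p }) (⊆-refl {x = parts μ}))

durfee≡count : ∀ μ → durfee μ ≡ count (λ x → suc x ≤? part μ (suc x)) (length (parts μ))
durfee≡count μ = trans (cong (length ∘ filter (λ i → i ≤? part μ i)) (map-applyUpTo id suc ℓ))
                       (length-filter-applyUpTo (λ i → i ≤? part μ i) suc ℓ)
  where ℓ = length (parts μ)

durfee-diagonal : ∀ μ {i} → i < durfee μ → suc i ≤ part μ (suc i)
durfee-diagonal μ i<s = count-downClosed (length (parts μ)) closed (subst (_ <_) (durfee≡count μ) i<s)
  where
    closed : ∀ x → suc (suc x) ≤ part μ (suc (suc x)) → suc x ≤ part μ (suc x)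
    closed x ≤part = ≤-trans (n≤1+n _) (≤-trans ≤part (part-antitone μ (n≤1+n x)))

≤-length-filter : ∀ ps {k} m → (∀ {x} → x < m → suc k ≤ at ps x) → m ≤ length (filter (suc k ≤?_) ps)
≤-length-filter ps       zero    _     = z≤n
≤-length-filter []       (suc m) large with large z<s
... | ()
≤-length-filter (p ∷ ps) {k} (suc m) large =
  subst (suc m ≤_) (sym (length-filter-∷ (suc k ≤?_) p ps)) (head-counted (suc k ≤? p))
  where
    head-counted : (k<p? : Dec (suc k ≤ p)) → suc m ≤ indicator (does k<p?) + length (filter (suc k ≤?_) ps)
    head-counted (yes _)  = s≤s (≤-length-filter ps m (λ x<m → large (s<s x<m)))
    head-counted (no k≮p) = contradiction (large z<s) k≮p

conj-diagonal : ∀ μ {i} → i < durfee μ → suc i ≤ conj μ (suc i)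
conj-diagonal μ {i} i<s =
  ≤-length-filter (parts μ) (suc i) (λ x<1+i → ≤-trans (durfee-diagonal μ i<s) (part-antitone μ (s≤s⁻¹ x<1+i)))

offsets-unique : ∀ (f : ℕ → ℕ) s → (∀ {i k} → i ≤ k → f (suc k) ≤ f (suc i)) →
                 (∀ {i} → i < s → suc i ≤ f (suc i)) → Unique (map (λ i → f i ∸ i) (oneTo s))
offsets-unique f s antitone diagonal =
  AllPairs.map⁺ (AllPairs.map⁺ (AllPairs.applyUpTo⁺₁ id s (λ i<k k<s → >⇒≢ (offset-decreases i<k k<s))))
  where
    offset-decreases : ∀ {i k} → i < k → k < s → f (suc k) ∸ suc k < f (suc i) ∸ suc i
    offset-decreases {i} {k} i<k k<s =
      ≤-<-trans (∸-monoˡ-≤ (suc k) (antitone (<⇒≤ i<k)))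
                (∸-monoʳ-< (s<s i<k) (≤-trans (diagonal k<s) (antitone (<⇒≤ i<k))))

A⁺-unique : ∀ μ → Unique (A⁺ μ)
A⁺-unique μ = offsets-unique (part μ) (durfee μ) (part-antitone μ) (durfee-diagonal μ)

L⁺-unique : ∀ μ → Unique (L⁺ μ)
L⁺-unique μ = offsets-unique (conj μ) (durfee μ) (conj-antitone μ ∘ s≤s) (conj-diagonal μ)

length-A⁺ : ∀ μ → length (A⁺ μ) ≡ durfee μ
length-A⁺ μ = trans (length-map _ (oneTo (durfee μ)))
                    (trans (length-map suc (upTo (durfee μ))) (length-upTo (durfee μ)))

module _ (t : ℕ) .{{_ : NonZero t}} where

  [q*t+r]%t≡r : ∀ q {r} → r < t → (q * t + r) % t ≡ r
  [q*t+r]%t≡r q {r} r<t = trans (cong (_% t) (+-comm (q * t) r)) (trans ([m+kn]%n≡m%n r q t) (m<n⇒m%n≡m r<t))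

  [q*t+r]/t≡q : ∀ q {r} → r < t → (q * t + r) / t ≡ q
  [q*t+r]/t≡q q {r} r<t = begin
    (q * t + r) / t     ≡⟨ +-distrib-/ (q * t) r (subst (_< t) (sym (cong₂ _+_ (m*n%n≡0 q t) (m<n⇒m%n≡m r<t))) r<t) ⟩
    q * t / t + r / t   ≡⟨ cong₂ _+_ (m*n/n≡m q t) (m<n⇒m/n≡0 r<t) ⟩
    q + 0               ≡⟨ +-identityʳ q ⟩
    q                   ∎

  %-/-injective : ∀ a b → a % t ≡ b % t → a / t ≡ b / t → a ≡ b
  %-/-injective a b a%t≡b%t a/t≡b/t = begin
    a                  ≡⟨ m≡m%n+[m/n]*n a t ⟩
    a % t + a / t * t  ≡⟨ cong₂ (λ r q → r + q * t) a%t≡b%t a/t≡b/t ⟩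
    b % t + b / t * t  ≡⟨ m≡m%n+[m/n]*n b t ⟨
    b                  ∎

  *+-injective : ∀ {q q′ r r′} → r < t → r′ < t → q * t + r ≡ q′ * t + r′ → q ≡ q′ × r ≡ r′
  *+-injective {q} {q′} r<t r′<t eq =
    trans (sym ([q*t+r]/t≡q q r<t)) (trans (cong (_/ t) eq) ([q*t+r]/t≡q q′ r′<t)) ,
    trans (sym ([q*t+r]%t≡r q r<t)) (trans (cong (_% t) eq) ([q*t+r]%t≡r q′ r′<t))

  residues : ℕ → List ℕ → List ℕ
  residues r = filter (λ a → a % t ≟ r)

  -- Ã⁺ t λ j is definitionally quotients (toℕ j) (A⁺ λ).
  quotients : ℕ → List ℕ → List ℕ
  quotients r xs = map (_/ t) (residues r xs)

  length-residues : ∀ xs → length xs ≡ Σ[j< t ] (λ j → length (residues (toℕ j) xs))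
  length-residues []       = sym (Σ-zero t)
  length-residues (x ∷ xs) = begin
    1 + length xs
      ≡⟨ cong₂ _+_ lands-in-one-class (sym (length-residues xs)) ⟨
    Σ[j< t ] (λ j → indicator (does (x % t ≟ toℕ j))) + Σ[j< t ] (λ j → length (residues (toℕ j) xs))
      ≡⟨ Σ-distrib-+ t _ _ ⟨
    Σ[j< t ] (λ j → indicator (does (x % t ≟ toℕ j)) + length (residues (toℕ j) xs))
      ≡⟨ Σ-cong t (λ j → length-filter-∷ (λ a → a % t ≟ toℕ j) x xs) ⟨
    Σ[j< t ] (λ j → length (residues (toℕ j) (x ∷ xs))) ∎
    where
      lands-in-one-class : Σ[j< t ] (λ j → indicator (does (x % t ≟ toℕ j))) ≡ 1
      lands-in-one-class = begin
        Σ[j< t ] (λ j → indicator (does (x % t ≟ toℕ j))) ≡⟨ Σ-indicator t (x % t ≟_) ⟩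
        count (x % t ≟_) t                                 ≡⟨ count-cong t (x % t ≟_) (_≟ x % t) (λ _ → mk⇔ sym sym) ⟩
        count (_≟ x % t) t                                 ≡⟨ count-≡ (m%n<n x t) ⟩
        1                                                  ∎

  quotients-unique : ∀ r {xs} → Unique xs → Unique (quotients r xs)
  quotients-unique r {xs} uxs = go (Unique.filter⁺ _ uxs) (All.all-filter (λ a → a % t ≟ r) xs)
    where
      go : ∀ {ys} → Unique ys → All (λ a → a % t ≡ r) ys → Unique (map (_/ t) ys)
      go []             []              = []
      go (a∉ys ∷ uys) (a%t ∷ ys%t) =
        All.map⁺ (All.zipWith (λ (a≢b , b%t) a/t≡b/t → a≢b (%-/-injective _ _ (trans a%t (sym b%t)) a/t≡b/t))
                              (a∉ys , ys%t))
        ∷ go uys ys%t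

  ∈-quotients : ∀ {r xs q} → r < t → q ∈ quotients r xs ⇔ q * t + r ∈ xs
  ∈-quotients {r} {xs} {q} r<t = mk⇔ to′ from′
    where
      to′ : q ∈ quotients r xs → q * t + r ∈ xs
      to′ q∈ with a , a∈ , refl ← ∈-map⁻ (_/ t) q∈ =
        let a∈xs , a%t≡r = ∈-filter⁻ (λ a → a % t ≟ r) a∈
        in subst (_∈ xs) (%-/-injective _ _ (trans a%t≡r (sym ([q*t+r]%t≡r (a / t) r<t)))
                                           (sym ([q*t+r]/t≡q (a / t) r<t))) a∈xs
      from′ : q * t + r ∈ xs → q ∈ quotients r xs
      from′ m = subst (_∈ quotients r xs) ([q*t+r]/t≡q q r<t)
                      (∈-map⁺ (_/ t) (∈-filter⁺ (λ a → a % t ≟ r) m ([q*t+r]%t≡r q r<t)))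

  durfee≡Σ-length-Ã⁺ : ∀ μ → durfee μ ≡ Σ[j< t ] (λ j → length (Ã⁺ t μ j))
  durfee≡Σ-length-Ã⁺ μ =
    trans (sym (length-A⁺ μ))
          (trans (length-residues (A⁺ μ))
                 (Σ-cong t (λ j → sym (length-map (_/ t) (residues (toℕ j) (A⁺ μ))))))

  Ã⁺-unique : ∀ μ j → Unique (Ã⁺ t μ j)
  Ã⁺-unique μ j = quotients-unique (toℕ j) (A⁺-unique μ)

positivePart : ℤ → ℕ
positivePart (ℤ.+ n)    = n
positivePart ℤ.-[1+ _ ] = 0

+<⇔<positivePart : ∀ {q} c → ℤ.+ q ℤ.< c ⇔ q < positivePart c
+<⇔<positivePart (ℤ.+ n)    = mk⇔ (λ { (ℤ.+<+ q<n) → q<n }) ℤ.+<+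
+<⇔<positivePart ℤ.-[1+ _ ] = mk⇔ (λ ()) (λ ())

+[1+m+n]+-[1+m]≡+n : ∀ m n → ℤ.+ (suc m + n) ℤ.+ ℤ.-[1+ m ] ≡ ℤ.+ n
+[1+m+n]+-[1+m]≡+n m n = trans (ℤ.⊖-≥ (m≤m+n (suc m) n)) (cong ℤ.+_ (m+n∸m≡n (suc m) n))

+m-+n-1≡+[m∸1+n] : ∀ {m n} → n < m → ℤ.+ m ℤ.- ℤ.+ n ℤ.- ℤ.+ 1 ≡ ℤ.+ (m ∸ suc n)
+m-+n-1≡+[m∸1+n] {m} {n} n<m =
  cong (ℤ._- ℤ.+ 1) (trans (ℤ.[+m]-[+n]≡m⊖n m n) (trans (ℤ.⊖-≥ (<⇒≤ n<m)) (cong ℤ.+_ (+-∸-assoc 1 n<m))))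

module _ (t : ℕ) .{{_ : NonZero t}} (la : Partition) (j : Fin t) where

  length-Ã⁺+αTerm : ∀ n μ →
    (∀ x → x ∈ A⁺ μ ⇔ InS t la j (ℤ.+ x ℤ.+ ℤ.+ n)) →
    (∀ y → y ∈ L⁺ μ ⇔ (¬ InS t la j (ℤ.+ n ℤ.- ℤ.+ y ℤ.- ℤ.+ 1))) →
    length (Ã⁺ t la j) + αTerm (ℤ.+ n) μ ≡ durfee μ + n
  length-Ã⁺+αTerm n μ arms legs = begin
    length (Ã⁺ t la j) + α    ≡⟨ cong (_+ α) (length-split n (Ã⁺-unique t la j) (A⁺-unique μ) shifted) ⟩
    length (A⁺ μ) + below + α ≡⟨ cong (λ k → k + below + α) (length-A⁺ μ) ⟩
    durfee μ + below + α      ≡⟨ +-assoc (durfee μ) below α ⟩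
    durfee μ + (below + α)    ≡⟨ cong (durfee μ +_) (length-filter-<-reflect n Ã-unique (L⁺-unique μ) reflected) ⟩
    durfee μ + n              ∎
    where
      α = αTerm (ℤ.+ n) μ
      below = length (filter (_<? n) (Ã⁺ t la j))
      Ã-unique = Ã⁺-unique t la j
      shifted : ∀ x → x ∈ A⁺ μ ⇔ n + x ∈ Ã⁺ t la j
      shifted x = subst (λ y → x ∈ A⁺ μ ⇔ y ∈ Ã⁺ t la j) (+-comm x n) (arms x)
      reflected : ∀ {y} → y < n → y ∈ L⁺ μ ⇔ n ∸ suc y ∉ Ã⁺ t la j
      reflected {y} y<n = subst (λ c → y ∈ L⁺ μ ⇔ (¬ InS t la j c)) (+m-+n-1≡+[m∸1+n] y<n) (legs y)

  length-Ã⁺+βTerm : ∀ m μ → (∀ x → x ∈ A⁺ μ ⇔ InS t la j (ℤ.+ x ℤ.+ ℤ.-[1+ m ])) →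
                    length (Ã⁺ t la j) + βTerm ℤ.-[1+ m ] μ ≡ durfee μ
  length-Ã⁺+βTerm m μ arms =
    trans (sym (length-split (suc m) (A⁺-unique μ) (Ã⁺-unique t la j) shifted)) (length-A⁺ μ)
    where
      shifted : ∀ x → x ∈ Ã⁺ t la j ⇔ suc m + x ∈ A⁺ μ
      shifted x = ⇔-sym (subst (λ c → suc m + x ∈ A⁺ μ ⇔ InS t la j c)
                               (+[1+m+n]+-[1+m]≡+n m x) (arms (suc m + x)))

  length-Ã⁺+αTerm+βTerm : ∀ c μ →
    (∀ x → x ∈ A⁺ μ ⇔ InS t la j (ℤ.+ x ℤ.+ c)) →
    (∀ y → y ∈ L⁺ μ ⇔ (¬ InS t la j (c ℤ.- ℤ.+ y ℤ.- ℤ.+ 1))) →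
    length (Ã⁺ t la j) + αTerm c μ + βTerm c μ ≡ durfee μ + positivePart c
  length-Ã⁺+αTerm+βTerm (ℤ.+ n) μ arms legs =
    trans (+-identityʳ (length (Ã⁺ t la j) + αTerm (ℤ.+ n) μ)) (length-Ã⁺+αTerm n μ arms legs)
  length-Ã⁺+αTerm+βTerm ℤ.-[1+ m ] μ arms _ =
    trans (cong (_+ βTerm ℤ.-[1+ m ] μ) (+-identityʳ (length (Ã⁺ t la j))))
          (trans (length-Ã⁺+βTerm m μ arms) (sym (+-identityʳ (durfee μ))))

  length-Ã⁺-balanced : ∀ μ → charVec t la j ≡ 0ℤ → IsQuotient t la j μ → length (Ã⁺ t la j) ≡ durfee μ
  length-Ã⁺-balanced μ c≡0 (arms , _) =
    trans (length-cong (Ã⁺-unique t la j) (A⁺-unique μ) same-members) (length-A⁺ μ)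
    where
      x+c≡x : ∀ x → ℤ.+ x ℤ.+ charVec t la j ≡ ℤ.+ x
      x+c≡x x = trans (cong (λ c → ℤ.+ x ℤ.+ c) c≡0) (ℤ.+-identityʳ (ℤ.+ x))
      same-members : ∀ x → x ∈ Ã⁺ t la j ⇔ x ∈ A⁺ μ
      same-members x = ⇔-sym (subst (λ c → x ∈ A⁺ μ ⇔ InS t la j c) (x+c≡x x) (arms x))

  length-Ã⁺-core : ∀ core → IsCore t la core → length (Ã⁺ t core j) ≡ positivePart (charVec t la j)
  length-Ã⁺-core core (arms , _) =
    trans (length-cong (Ã⁺-unique t core j) (Unique.upTo⁺ c⁺)
                       (λ q → ⇔-trans (∈-quotients t (toℕ<n j)) (in-core q)))
          (length-upTo c⁺)
    where
      c⁺ = positivePart (charVec t la j)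
      in-core : ∀ q → q * t + toℕ j ∈ A⁺ core ⇔ q ∈ upTo c⁺
      in-core q = mk⇔ to′ (λ q∈ → from (arms _) (j , q , from (+<⇔<positivePart _) (∈-upTo⁻ q∈) , refl))
        where
          to′ : q * t + toℕ j ∈ A⁺ core → q ∈ upTo c⁺
          to′ q∈ with j′ , q′ , q′<c , eq ← to (arms _) q∈
                 with refl , j≡j′ ← *+-injective t {q} {q′} (toℕ<n j) (toℕ<n j′) eq =
            ∈-upTo⁺ (subst (λ i → q < positivePart (charVec t la i)) (sym (toℕ-injective j≡j′))
                           (to (+<⇔<positivePart _) q′<c))

corollary3p29 : (t : ℕ) .{{_ : NonZero t}} (la : Partition) (quo : Fin t → Partition)
    (Q core : Partition) →
    (∀ j → IsQuotient t la j (quo j)) →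
    (∀ j → charVec t Q j ≡ 0ℤ) → (∀ j → IsQuotient t Q j (quo j)) →
    IsCore t la core →
    (durfee Q ≡ Σ[j< t ] (λ j → durfee (quo j))) ×
    (durfee la + Σ[j< t ] (λ j → αTerm (charVec t la j) (quo j))
               + Σ[j< t ] (λ j → βTerm (charVec t la j) (quo j))
      ≡ durfee Q + durfee core)
corollary3p29 t la quo Q core quo-of-la Q-balanced quo-of-Q core-of-la = durfee-Q , durfee-la
  where
    a α β s c⁺ : Fin t → ℕ
    a  j = length (Ã⁺ t la j)
    α  j = αTerm (charVec t la j) (quo j)
    β  j = βTerm (charVec t la j) (quo j)
    s  j = durfee (quo j)
    c⁺ j = positivePart (charVec t la j)

    durfee-Q : durfee Q ≡ Σ[j< t ] s
    durfee-Q = trans (durfee≡Σ-length-Ã⁺ t Q)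
                     (Σ-cong t (λ j → length-Ã⁺-balanced t Q j (quo j) (Q-balanced j) (quo-of-Q j)))

    durfee-core : durfee core ≡ Σ[j< t ] c⁺
    durfee-core = trans (durfee≡Σ-length-Ã⁺ t core) (Σ-cong t (λ j → length-Ã⁺-core t la j core core-of-la))

    durfee-la : durfee la + Σ[j< t ] α + Σ[j< t ] β ≡ durfee Q + durfee core
    durfee-la = begin
      durfee la + Σ[j< t ] α + Σ[j< t ] β
        ≡⟨ cong (λ d → d + Σ[j< t ] α + Σ[j< t ] β) (durfee≡Σ-length-Ã⁺ t la) ⟩
      Σ[j< t ] a + Σ[j< t ] α + Σ[j< t ] β
        ≡⟨ trans (Σ-distrib-+ t (λ j → a j + α j) β) (cong (_+ Σ[j< t ] β) (Σ-distrib-+ t a α)) ⟨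
      Σ[j< t ] (λ j → a j + α j + β j)
        ≡⟨ Σ-cong t (λ j → length-Ã⁺+αTerm+βTerm t la j (charVec t la j) (quo j)
                                                  (proj₁ (quo-of-la j)) (proj₂ (quo-of-la j))) ⟩
      Σ[j< t ] (λ j → s j + c⁺ j)
        ≡⟨ Σ-distrib-+ t s c⁺ ⟩
      Σ[j< t ] s + Σ[j< t ] c⁺
        ≡⟨ cong₂ _+_ durfee-Q durfee-core ⟨
      durfee Q + durfee core ∎
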